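{- Let $P=(h_1,\dots,h_k)$ be a sequence of positive integers, let $m\geq 3$, and let $M=\{a,a+1,\dots,a+m-1\}\subseteq[k]$ be a block of positions with $h_\alpha=h_a$ for all $\alpha\in M$. Let $X$ be an $\mathrm{ROS}(P)$ which is similar with respect to $M$, with associated values $X'$. Then: (1) for distinct $i,j\notin M$, $X'(i,j,a)=\frac{1}{m}\left(h_ih_j-\sum_{\ell\notin M}X(i,j,\ell)\right)$; (2) for $i\notin M$, $X'(i,a,a)=\frac{1}{m-1}\left(h_ih_a-\frac{1}{m}\sum_{\ell\notin M\cup\{i\}}h_ih_\ell+\frac{2}{m}\sum_{\substack{j,\ell\notin M\cup\{i\}\\ j<\ell}}X(i,j,\ell)\right)$; (3) $X'(a,a,a)=\frac{1}{m(m-1)(m-2)}\left(m(m-1)h_a^2-mh_a\sum_{i\notin M}h_i+2\sum_{\substack{i,j\notin M\\ i<j}}h_ih_j-6\sum_{\substack{i,j,\ell\notin M\\ i<j<\ell}}X(i,j,\ell)\right)$.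
   Context: An $\mathrm{ROS}(P)$ is an assignment of a non-negative rational number $X(i,j,\ell)$ to every multiset $\{i,j,\ell\}$ of elements of $[k]$ (invariant under permuting $i,j,\ell$) such that $\sum_{\ell\in[k]}X(i,j,\ell)=h_ih_j$ for all $i,j\in[k]$, and $X(i,i,i)=h_i^2$ and $X(i,i,j)=0$ for all $i\neq j$. $X$ is similar with respect to $M$ if there exist non-negative values $X'(i,j,a)$, $X'(i,a,a)$ (for $i,j\notin M$) and $X'(a,a,a)$ such that for all distinct $\alpha,\beta,\gamma\in M$ and all $i,j\notin M$: $X(i,j,\alpha)=X'(i,j,a)$, $X(i,\alpha,\beta)=X'(i,a,a)$, and $X(\alpha,\beta,\gamma)=X'(a,a,a)$. -}

module Defs where

open import Data.Nat using (ℕ; zero; suc; _≤_; _<_; _≤ᵇ_; _<ᵇ_) renaming (_+_ to _+ℕ_)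
open import Data.Bool using (Bool; true; false; if_then_else_; not; _∧_)
open import Data.Fin using (Fin; toℕ)
import Data.Fin as Fin
open import Data.Integer using (+_)
open import Data.Rational using (ℚ; 0ℚ; _+_; _*_; _/_) renaming (_≤_ to _≤ℚ_)
open import Relation.Nullary using (¬_)
open import Data.Product using (_×_)
open import Relation.Binary.PropositionalEquality using (_≡_; _≢_)

ℕ→ℚ : ℕ → ℚ
ℕ→ℚ n = (+ n) / 1

-- 1/n as a rational, for n ≥ 1 (junk value 0 at n = 0, never used below)
inv : ℕ → ℚ
inv zero    = 0ℚ
inv (suc n) = (+ 1) / suc n

∑ : ∀ {n} → (Fin n → ℚ) → ℚ
∑ {zero}  f = 0ℚ
∑ {suc n} f = f Fin.zero + ∑ (λ i → f (Fin.suc i))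

∑[_] : ∀ {n} → (Fin n → Bool) → (Fin n → ℚ) → ℚ
∑[ P ] f = ∑ (λ i → if P i then f i else 0ℚ)

-- The block M = {a, a+1, ..., a+m-1} (0-indexed positions in Fin k)
InM : ∀ {k} → (a : Fin k) (m : ℕ) → Fin k → Set
InM a m i = toℕ a ≤ toℕ i × toℕ i < toℕ a +ℕ m

inMᵇ : ∀ {k} → (a : Fin k) (m : ℕ) → Fin k → Bool
inMᵇ a m i = (toℕ a ≤ᵇ toℕ i) ∧ (toℕ i <ᵇ toℕ a +ℕ m)

notInMᵇ : ∀ {k} → (a : Fin k) (m : ℕ) → Fin k → Bool
notInMᵇ a m i = not (inMᵇ a m i)

_<ᶠ_ : ∀ {k} → Fin k → Fin k → Bool
i <ᶠ j = toℕ i <ᵇ toℕ j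

-- X is an ROS(P), P = h.  X is a function of three indices, invariant under
-- permutations (the two transpositions below generate S₃), i.e. a function
-- on multisets {i,j,ℓ}.
record IsROS {k : ℕ} (h : Fin k → ℕ) (X : Fin k → Fin k → Fin k → ℚ) : Set where
  field
    nonneg  : ∀ i j l → 0ℚ ≤ℚ X i j l
    sym₁₂   : ∀ i j l → X i j l ≡ X j i l
    sym₂₃   : ∀ i j l → X i j l ≡ X i l j
    rowSum  : ∀ i j → ∑ (λ l → X i j l) ≡ ℕ→ℚ (h i) * ℕ→ℚ (h j)
    diag    : ∀ i → X i i i ≡ ℕ→ℚ (h i) * ℕ→ℚ (h i)
    offDiag : ∀ i j → i ≢ j → X i i j ≡ 0ℚ

-- X is similar with respect to M = {a,…,a+m-1}, with associated values
--   X'(i,j,a) = Y₁ i j,  X'(i,a,a) = Y₂ i,  X'(a,a,a) = Y₃   (i, j ∉ M).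
record IsSimilar {k : ℕ} (a : Fin k) (m : ℕ) (X : Fin k → Fin k → Fin k → ℚ)
                 (Y₁ : Fin k → Fin k → ℚ) (Y₂ : Fin k → ℚ) (Y₃ : ℚ) : Set where
  field
    Y₁-nonneg : ∀ i j → 0ℚ ≤ℚ Y₁ i j
    Y₂-nonneg : ∀ i → 0ℚ ≤ℚ Y₂ i
    Y₃-nonneg : 0ℚ ≤ℚ Y₃
    sim₁ : ∀ i j α → ¬ InM a m i → ¬ InM a m j → InM a m α → X i j α ≡ Y₁ i j
    sim₂ : ∀ i α β → ¬ InM a m i → InM a m α → InM a m β → α ≢ β → X i α β ≡ Y₂ i
    sim₃ : ∀ α β γ → InM a m α → InM a m β → InM a m γ →
           α ≢ β → β ≢ γ → α ≢ γ → X α β γ ≡ Y₃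

_≡ᶠ_ : ∀ {k} → Fin k → Fin k → Bool
i ≡ᶠ j = toℕ i Data.Nat.≡ᵇ toℕ j

{-# OPTIONS --safe #-}
-- Each identity is the row-sum condition ∑ₗ X(i,j,l) = hᵢhⱼ, read at the pair (i,j) for (1),
-- (i,a) for (2) and (a,a+1) for (3), split into l ∈ M and l ∉ M.  On M, similarity makes the
-- row constant except where l repeats an index of the pair, and there X(i,i,j) = 0; this
-- leaves m·X'(i,j,a), (m-1)·X'(i,a,a) and (m-2)·X'(a,a,a).  Off M, the row of (2) consists of
-- the values X'(i,l,a) and that of (3) of the values X'(l,a,a), which the previous identities
-- express through X and h.  The double and triple sums produced this way run over ordered
-- tuples of distinct indices; by the symmetry of X they are twice, resp. three times, the sums
-- over increasing tuples in the statement.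
module Submission where

open import Defs
open import Data.Nat using (ℕ; zero; suc; _≤_; _<_; _∸_; s≤s; z<s; NonZero; _≤ᵇ_; _<ᵇ_)
  renaming (_+_ to _+ℕ_; _*_ to _*ℕ_)
open import Data.Fin using (Fin; toℕ; fromℕ<) renaming (zero to fz; suc to fs)
import Data.Fin.Properties as Fin
import Data.Nat.Properties as ℕ
open import Data.Bool using (Bool; true; false; not; _∧_; if_then_else_)
open import Data.Bool.Properties using (∧-identityʳ; ∧-comm; ∧-assoc; T-≡; T-∧)
open import Function.Bundles using (Equivalence)
open import Data.Rational using (ℚ; mkℚ; 0ℚ; 1ℚ; _+_; _-_; _*_; -_; toℚᵘ)
import Data.Rational.Properties as ℚ
import Data.Rational.Unnormalised as ℚᵘ
import Data.Rational.Unnormalised.Properties as ℚᵘ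
import Data.Integer as ℤ
open import Data.Nat.Coprimality using (1-coprimeTo) renaming (sym to coprime-sym)
import Data.Integer.Tactic.RingSolver as ℤ-Solver
open import Relation.Binary.PropositionalEquality
open import Relation.Nullary using (¬_; contradiction)
open import Data.Product using (_×_; _,_)
open import Function using (case_of_; _∘_)
open import Relation.Nullary.Decidable using (dec⇒maybe)
open import Level using (0ℓ)
open import Tactic.RingSolver using (solve-∀)
open import Tactic.RingSolver.Core.AlmostCommutativeRing
  using (AlmostCommutativeRing; fromCommutativeRing)

ℚ-ring : AlmostCommutativeRing 0ℓ 0ℓ
ℚ-ring = fromCommutativeRing ℚ.+-*-commutativeRing (λ x → dec⇒maybe (0ℚ ℚ.≟ x))

ℕ→ℚ≡mkℚ : ∀ n → ℕ→ℚ n ≡ mkℚ (ℤ.+ n) 0 (coprime-sym (1-coprimeTo n))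
ℕ→ℚ≡mkℚ n = ℚ.normalize-coprime _

inv≡mkℚ : ∀ n → inv (suc n) ≡ mkℚ (ℤ.+ 1) n (1-coprimeTo (suc n))
inv≡mkℚ n = ℚ.normalize-coprime _

ℕ→ℚ-+ : ∀ x y → ℕ→ℚ (x +ℕ y) ≡ ℕ→ℚ x + ℕ→ℚ y
ℕ→ℚ-+ x y = ℚ.toℚᵘ-injective
  (ℚᵘ.≃-trans homo (ℚᵘ.≃-sym (ℚ.toℚᵘ-homo-+ (ℕ→ℚ x) (ℕ→ℚ y))))
  where
  -- at a = + x and b = + y, the integer a ℤ.+ b computes to + (x + y)
  distrib : ∀ a b → (a ℤ.+ b) ℤ.* ℤ.+ 1 ≡ (a ℤ.* ℤ.+ 1 ℤ.+ b ℤ.* ℤ.+ 1) ℤ.* ℤ.+ 1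
  distrib = ℤ-Solver.solve-∀
  homo : toℚᵘ (ℕ→ℚ (x +ℕ y)) ℚᵘ.≃ toℚᵘ (ℕ→ℚ x) ℚᵘ.+ toℚᵘ (ℕ→ℚ y)
  homo rewrite ℕ→ℚ≡mkℚ x | ℕ→ℚ≡mkℚ y | ℕ→ℚ≡mkℚ (x +ℕ y) = ℚᵘ.*≡* (distrib (ℤ.+ x) (ℤ.+ y))

ℕ→ℚ-suc-* : ∀ n c → ℕ→ℚ (suc n) * c ≡ c + ℕ→ℚ n * c
ℕ→ℚ-suc-* n c = begin
  ℕ→ℚ (suc n) * c         ≡⟨ cong (_* c) (ℕ→ℚ-+ 1 n) ⟩
  (1ℚ + ℕ→ℚ n) * c        ≡⟨ ℚ.*-distribʳ-+ c 1ℚ (ℕ→ℚ n) ⟩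
  1ℚ * c + ℕ→ℚ n * c      ≡⟨ cong (_+ ℕ→ℚ n * c) (ℚ.*-identityˡ c) ⟩
  c + ℕ→ℚ n * c           ∎
  where open ≡-Reasoning

ℕ→ℚ-* : ∀ x y → ℕ→ℚ (x *ℕ y) ≡ ℕ→ℚ x * ℕ→ℚ y
ℕ→ℚ-* zero    y = sym (ℚ.*-zeroˡ (ℕ→ℚ y))
ℕ→ℚ-* (suc x) y = begin
  ℕ→ℚ (y +ℕ x *ℕ y)             ≡⟨ ℕ→ℚ-+ y (x *ℕ y) ⟩
  ℕ→ℚ y + ℕ→ℚ (x *ℕ y)          ≡⟨ cong (ℕ→ℚ y +_) (ℕ→ℚ-* x y) ⟩
  ℕ→ℚ y + ℕ→ℚ x * ℕ→ℚ y         ≡⟨ ℕ→ℚ-suc-* x (ℕ→ℚ y) ⟨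
  ℕ→ℚ (suc x) * ℕ→ℚ y           ∎
  where open ≡-Reasoning

inv-inverseˡ : ∀ n .{{_ : NonZero n}} → inv n * ℕ→ℚ n ≡ 1ℚ
inv-inverseˡ (suc n) rewrite inv≡mkℚ n | ℕ→ℚ≡mkℚ (suc n) =
  ℚ.*-inverseˡ (mkℚ (ℤ.+ suc n) 0 (coprime-sym (1-coprimeTo (suc n))))

divide-by : ∀ n .{{_ : NonZero n}} {y z} → ℕ→ℚ n * y ≡ z → y ≡ inv n * z
divide-by n {y} refl = begin
  y                          ≡⟨ ℚ.*-identityˡ y ⟨
  1ℚ * y                     ≡⟨ cong (_* y) (inv-inverseˡ n) ⟨
  (inv n * ℕ→ℚ n) * y        ≡⟨ ℚ.*-assoc (inv n) (ℕ→ℚ n) y ⟩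
  inv n * (ℕ→ℚ n * y)        ∎
  where open ≡-Reasoning

∑-cong : ∀ {n} {f g : Fin n → ℚ} → (∀ i → f i ≡ g i) → ∑ f ≡ ∑ g
∑-cong {zero}  f≗g = refl
∑-cong {suc n} f≗g = cong₂ _+_ (f≗g fz) (∑-cong (λ i → f≗g (fs i)))

∑-zero : ∀ n → ∑ {n} (λ _ → 0ℚ) ≡ 0ℚ
∑-zero zero    = refl
∑-zero (suc n) = trans (ℚ.+-identityˡ _) (∑-zero n)

∑-+ : ∀ {n} (f g : Fin n → ℚ) → ∑ (λ i → f i + g i) ≡ ∑ f + ∑ g
∑-+ {zero}  f g = refl
∑-+ {suc n} f g = trans (cong (f fz + g fz +_) (∑-+ (λ i → f (fs i)) (λ i → g (fs i))))
                        (interchange (f fz) (g fz) _ _)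
  where
  interchange : ∀ a b c d → (a + b) + (c + d) ≡ (a + c) + (b + d)
  interchange = solve-∀ ℚ-ring

∑-*ˡ : ∀ {n} c (f : Fin n → ℚ) → ∑ (λ i → c * f i) ≡ c * ∑ f
∑-*ˡ {zero}  c f = sym (ℚ.*-zeroʳ c)
∑-*ˡ {suc n} c f = trans (cong (c * f fz +_) (∑-*ˡ c (λ i → f (fs i))))
                         (sym (ℚ.*-distribˡ-+ c (f fz) _))

∑-neg : ∀ {n} (f : Fin n → ℚ) → ∑ (λ i → - f i) ≡ - ∑ f
∑-neg {zero}  f = refl
∑-neg {suc n} f = trans (cong (- f fz +_) (∑-neg (λ i → f (fs i))))
                        (sym (ℚ.neg-distrib-+ (f fz) _))

∑[]-complement : ∀ {n} (P : Fin n → Bool) (f : Fin n → ℚ) →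
                 ∑[ P ] f ≡ ∑ f - ∑[ (λ i → not (P i)) ] f
∑[]-complement P f = begin
  A             ≡⟨ cancel A B ⟩
  (A + B) - B   ≡⟨ cong (_- B) (trans (sym (∑-+ (λ i → if P i then f i else 0ℚ)
                                                 (λ i → if not (P i) then f i else 0ℚ)))
                                      (∑-cong split)) ⟩
  ∑ f - B       ∎
  where
  open ≡-Reasoning
  A B : ℚ
  A = ∑[ P ] f
  B = ∑[ (λ i → not (P i)) ] f
  cancel : ∀ x y → x ≡ (x + y) - y
  cancel = solve-∀ ℚ-ring
  split : ∀ i → (if P i then f i else 0ℚ) + (if not (P i) then f i else 0ℚ) ≡ f i
  split i with P i
  ... | true  = ℚ.+-identityʳ (f i)
  ... | false = ℚ.+-identityˡ (f i)

∑[]-cong : ∀ {n} (P : Fin n → Bool) {f g : Fin n → ℚ} →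
           (∀ i → P i ≡ true → f i ≡ g i) → ∑[ P ] f ≡ ∑[ P ] g
∑[]-cong P {f} {g} f≗g = ∑-cong pointwise
  where
  pointwise : ∀ i → (if P i then f i else 0ℚ) ≡ (if P i then g i else 0ℚ)
  pointwise i with P i in Pi
  ... | true  = f≗g i Pi
  ... | false = refl

∑[]-congᴾ : ∀ {n} {P Q : Fin n → Bool} (f : Fin n → ℚ) → (∀ i → P i ≡ Q i) → ∑[ P ] f ≡ ∑[ Q ] f
∑[]-congᴾ f P≗Q = ∑-cong (λ i → cong (λ b → if b then f i else 0ℚ) (P≗Q i))

∑[]-zero : ∀ {n} (P : Fin n → Bool) → ∑[ P ] (λ _ → 0ℚ) ≡ 0ℚ
∑[]-zero {n} P = trans (∑-cong (λ i → if-zero (P i))) (∑-zero n)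
  where
  if-zero : ∀ b → (if b then 0ℚ else 0ℚ) ≡ 0ℚ
  if-zero true  = refl
  if-zero false = refl

∑[]-+ : ∀ {n} (P : Fin n → Bool) (f g : Fin n → ℚ) →
        ∑[ P ] (λ i → f i + g i) ≡ ∑[ P ] f + ∑[ P ] g
∑[]-+ P f g = trans (∑-cong (λ i → if-+ (P i) (f i) (g i)))
  (∑-+ (λ i → if P i then f i else 0ℚ) (λ i → if P i then g i else 0ℚ))
  where
  if-+ : ∀ b x y → (if b then x + y else 0ℚ) ≡ (if b then x else 0ℚ) + (if b then y else 0ℚ)
  if-+ true  x y = refl
  if-+ false x y = refl

∑[]-*ˡ : ∀ {n} (P : Fin n → Bool) c (f : Fin n → ℚ) →
         ∑[ P ] (λ i → c * f i) ≡ c * ∑[ P ] f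
∑[]-*ˡ P c f = trans (∑-cong (λ i → if-* (P i) (f i)))
  (∑-*ˡ c (λ i → if P i then f i else 0ℚ))
  where
  if-* : ∀ b x → (if b then c * x else 0ℚ) ≡ c * (if b then x else 0ℚ)
  if-* true  x = refl
  if-* false x = sym (ℚ.*-zeroʳ c)

∑[]-- : ∀ {n} (P : Fin n → Bool) (f g : Fin n → ℚ) →
        ∑[ P ] (λ i → f i - g i) ≡ ∑[ P ] f - ∑[ P ] g
∑[]-- P f g = trans (∑-cong (λ i → if-- (P i) (f i) (g i)))
  (trans (∑-+ (λ i → if P i then f i else 0ℚ) (λ i → - (if P i then g i else 0ℚ)))
         (cong (∑[ P ] f +_) (∑-neg (λ i → if P i then g i else 0ℚ))))
  where
  if-- : ∀ b x y → (if b then x - y else 0ℚ) ≡ (if b then x else 0ℚ) - (if b then y else 0ℚ)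
  if-- true  x y = refl
  if-- false x y = refl

∑[]-∧ : ∀ {n} (P Q : Fin n → Bool) (f : Fin n → ℚ) →
        ∑[ (λ i → P i ∧ Q i) ] f ≡ ∑[ Q ] (λ i → if P i then f i else 0ℚ)
∑[]-∧ P Q f = ∑-cong pointwise
  where
  pointwise : ∀ i → (if P i ∧ Q i then f i else 0ℚ)
                  ≡ (if Q i then (if P i then f i else 0ℚ) else 0ℚ)
  pointwise i with P i | Q i
  ... | true  | _     = refl
  ... | false | true  = refl
  ... | false | false = refl

if-∑[]-∧ : ∀ {n} b (P Q : Fin n → Bool) (f : Fin n → ℚ) →
           (if b then ∑[ (λ i → P i ∧ Q i) ] f else 0ℚ)
             ≡ ∑[ Q ] (λ i → if b ∧ P i then f i else 0ℚ)
if-∑[]-∧ true  P Q f = ∑[]-∧ P Q f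
if-∑[]-∧ false P Q f = sym (∑[]-zero Q)

≡ᶠ⇒≡ : ∀ {k} (i j : Fin k) → (i ≡ᶠ j) ≡ true → i ≡ j
≡ᶠ⇒≡ fz     fz     _  = refl
≡ᶠ⇒≡ (fs i) (fs j) eq = cong fs (≡ᶠ⇒≡ i j eq)

≡ᶠ-refl : ∀ {k} (i : Fin k) → (i ≡ᶠ i) ≡ true
≡ᶠ-refl fz     = refl
≡ᶠ-refl (fs i) = ≡ᶠ-refl i

≢⇒≡ᶠ-false : ∀ {k} {i j : Fin k} → i ≢ j → (i ≡ᶠ j) ≡ false
≢⇒≡ᶠ-false {i = i} {j} i≢j with i ≡ᶠ j in i≡ᶠj
... | true  = contradiction (≡ᶠ⇒≡ i j i≡ᶠj) i≢j
... | false = refl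

∧-not-≡ᶠ⇒ : ∀ {k} b (j l : Fin k) → (b ∧ not (j ≡ᶠ l)) ≡ true → b ≡ true × j ≢ l
∧-not-≡ᶠ⇒ b j l eq with b | j ≡ᶠ l in j≡ᶠl
... | true | false = refl , λ { refl → case trans (sym (≡ᶠ-refl j)) j≡ᶠl of λ () }

∑[]-remove : ∀ {n} (P : Fin n → Bool) (j : Fin n) (f : Fin n → ℚ) → f j ≡ 0ℚ →
             ∑[ P ] f ≡ ∑[ (λ l → P l ∧ not (j ≡ᶠ l)) ] f
∑[]-remove P j f fj≡0 = ∑-cong pointwise
  where
  pointwise : ∀ l → (if P l then f l else 0ℚ) ≡ (if P l ∧ not (j ≡ᶠ l) then f l else 0ℚ)
  pointwise l with P l | j ≡ᶠ l in j≡ᶠl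
  ... | false | _     = refl
  ... | true  | false = refl
  ... | true  | true  = trans (cong f (sym (≡ᶠ⇒≡ j l j≡ᶠl))) fj≡0

count : ∀ {n} → (Fin n → Bool) → ℕ
count {zero}  P = 0
count {suc n} P = if P fz then suc (count (λ i → P (fs i))) else count (λ i → P (fs i))

count-cong : ∀ {n} {P Q : Fin n → Bool} → (∀ i → P i ≡ Q i) → count P ≡ count Q
count-cong {zero}  P≗Q = refl
count-cong {suc n} {P} {Q} P≗Q rewrite P≗Q fz = cong (λ c → if Q fz then suc c else c)
                                                     (count-cong (λ i → P≗Q (fs i)))

count-false : ∀ n → count {n} (λ _ → false) ≡ 0
count-false zero    = refl
count-false (suc n) = count-false n

count-remove : ∀ {n} (P : Fin n → Bool) (j : Fin n) → P j ≡ true →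
               count P ≡ suc (count (λ i → P i ∧ not (j ≡ᶠ i)))
count-remove P fz     Pj rewrite Pj = cong suc (count-cong (λ i → sym (∧-identityʳ (P (fs i)))))
count-remove P (fs j) Pj with P fz
... | true  = cong suc (count-remove (λ i → P (fs i)) j Pj)
... | false = count-remove (λ i → P (fs i)) j Pj

∑[]-const : ∀ {n} (P : Fin n → Bool) c → ∑[ P ] (λ _ → c) ≡ ℕ→ℚ (count P) * c
∑[]-const {zero}  P c = sym (ℚ.*-zeroˡ c)
∑[]-const {suc n} P c with P fz
... | true  = trans (cong (c +_) (∑[]-const (λ i → P (fs i)) c))
                    (sym (ℕ→ℚ-suc-* (count (λ i → P (fs i))) c))
... | false = trans (ℚ.+-identityˡ _) (∑[]-const (λ i → P (fs i)) c)

∑[]-constant-on : ∀ {n} (P : Fin n → Bool) {f : Fin n → ℚ} y {c} →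
                  (∀ i → P i ≡ true → f i ≡ y) → count P ≡ c → ∑[ P ] f ≡ ℕ→ℚ c * y
∑[]-constant-on P y f≡y refl = trans (∑[]-cong P f≡y) (∑[]-const P y)

<ᵇ-suc : ∀ m n → (m <ᵇ suc n) ≡ (m ≤ᵇ n)
<ᵇ-suc zero    n = refl
<ᵇ-suc (suc m) n = refl

count-interval : ∀ {k} A m → A +ℕ m ≤ k →
                 count {k} (λ i → (A ≤ᵇ toℕ i) ∧ (toℕ i <ᵇ A +ℕ m)) ≡ m
count-interval {suc k} (suc A) m    (s≤s A+m≤k) =
  trans (count-cong {k} (λ i → cong (_∧ (toℕ i <ᵇ A +ℕ m)) (<ᵇ-suc A (toℕ i))))
        (count-interval A m A+m≤k)
count-interval {k}     zero    zero    _           = count-false k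
count-interval {suc k} zero    (suc m) (s≤s m≤k)   = cong suc (count-interval zero m m≤k)

∑≢ ∑< : ∀ {n} → (Fin n → Fin n → ℚ) → ℚ
∑≢ G = ∑ (λ i → ∑[ (λ j → not (i ≡ᶠ j)) ] (G i))
∑< G = ∑ (λ i → ∑[ (i <ᶠ_) ] (G i))

∑≢< ∑<< : ∀ {n} → (Fin n → Fin n → Fin n → ℚ) → ℚ
∑≢< G = ∑ (λ i → ∑[ (λ j → not (i ≡ᶠ j)) ] (λ j → ∑[ (λ l → not (i ≡ᶠ l) ∧ (j <ᶠ l)) ] (G i j)))
∑<< G = ∑ (λ i → ∑[ (i <ᶠ_) ] (λ j → ∑[ (j <ᶠ_) ] (G i j)))

module _ {n : ℕ} where

  ∑<-suc : (G : Fin (suc n) → Fin (suc n) → ℚ) →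
           ∑< G ≡ ∑ (λ j → G fz (fs j)) + ∑< (λ i j → G (fs i) (fs j))
  ∑<-suc G = cong₂ _+_ (ℚ.+-identityˡ (∑ (λ j → G fz (fs j))))
                       (∑-cong (λ i → ℚ.+-identityˡ (∑[ (i <ᶠ_) ] (λ j → G (fs i) (fs j)))))

  ∑≢-suc : (G : Fin (suc n) → Fin (suc n) → ℚ) →
           ∑≢ G ≡ ∑ (λ j → G fz (fs j)) + (∑ (λ i → G (fs i) fz) + ∑≢ (λ i j → G (fs i) (fs j)))
  ∑≢-suc G = cong₂ _+_ (ℚ.+-identityˡ (∑ (λ j → G fz (fs j))))
                       (∑-+ (λ i → G (fs i) fz) (λ i → ∑[ (λ j → not (i ≡ᶠ j)) ] (λ j → G (fs i) (fs j))))

  ∑<<-suc : (G : Fin (suc n) → Fin (suc n) → Fin (suc n) → ℚ) →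
            ∑<< G ≡ ∑< (λ j l → G fz (fs j) (fs l)) + ∑<< (λ i j l → G (fs i) (fs j) (fs l))
  ∑<<-suc G = cong₂ _+_
    (trans (ℚ.+-identityˡ (∑ (λ j → ∑[ (fs j <ᶠ_) ] (G fz (fs j)))))
           (∑-cong (λ j → ℚ.+-identityˡ (∑[ (j <ᶠ_) ] (λ l → G fz (fs j) (fs l))))))
    (∑-cong (λ i →
      trans (ℚ.+-identityˡ (∑[ (i <ᶠ_) ] (λ j → ∑[ (fs j <ᶠ_) ] (G (fs i) (fs j)))))
            (∑[]-cong (i <ᶠ_) (λ j _ → ℚ.+-identityˡ (∑[ (j <ᶠ_) ] (λ l → G (fs i) (fs j) (fs l)))))))

  ∑≢<-suc : (G : Fin (suc n) → Fin (suc n) → Fin (suc n) → ℚ) →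
            ∑≢< G ≡ ∑< (λ j l → G fz (fs j) (fs l))
                    + (∑≢ (λ i l → G (fs i) fz (fs l)) + ∑≢< (λ i j l → G (fs i) (fs j) (fs l)))
  ∑≢<-suc G = cong₂ _+_
    (trans (ℚ.+-identityˡ (∑ (λ j → ∑[ (λ l → not (fz ≡ᶠ l) ∧ (fs j <ᶠ l)) ] (G fz (fs j)))))
           (∑-cong (λ j → ℚ.+-identityˡ (∑[ (j <ᶠ_) ] (λ l → G fz (fs j) (fs l))))))
    (trans (∑-cong (λ i → cong₂ _+_ (column i) (row i)))
           (∑-+ (λ i → ∑[ (λ l → not (i ≡ᶠ l)) ] (λ l → G (fs i) fz (fs l)))
                (λ i → ∑[ (λ j → not (i ≡ᶠ j)) ] (λ j →
                         ∑[ (λ l → not (i ≡ᶠ l) ∧ (j <ᶠ l)) ] (λ l → G (fs i) (fs j) (fs l))))))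
    where
    column : ∀ i → ∑[ (λ l → not (fs i ≡ᶠ l) ∧ (fz <ᶠ l)) ] (G (fs i) fz)
                 ≡ ∑[ (λ l → not (i ≡ᶠ l)) ] (λ l → G (fs i) fz (fs l))
    column i = trans (ℚ.+-identityˡ (∑[ (λ l → not (i ≡ᶠ l) ∧ true) ] (λ l → G (fs i) fz (fs l))))
                     (∑-cong (λ l → cong (λ b → if b then G (fs i) fz (fs l) else 0ℚ)
                                         (∧-identityʳ (not (i ≡ᶠ l)))))
    row : ∀ i → ∑[ (λ j → not (i ≡ᶠ j)) ] (λ j → ∑[ (λ l → not (fs i ≡ᶠ l) ∧ (fs j <ᶠ l)) ] (G (fs i) (fs j)))
              ≡ ∑[ (λ j → not (i ≡ᶠ j)) ] (λ j →
                  ∑[ (λ l → not (i ≡ᶠ l) ∧ (j <ᶠ l)) ] (λ l → G (fs i) (fs j) (fs l)))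
    row i = ∑[]-cong (λ j → not (i ≡ᶠ j)) (λ j _ →
              ℚ.+-identityˡ (∑[ (λ l → not (i ≡ᶠ l) ∧ (j <ᶠ l)) ] (λ l → G (fs i) (fs j) (fs l))))

∑≢-symmetric : ∀ {n} (G : Fin n → Fin n → ℚ) → (∀ i j → G i j ≡ G j i) → ∑≢ G ≡ ∑< G + ∑< G
∑≢-symmetric {zero}  G G-sym = refl
∑≢-symmetric {suc n} G G-sym = begin
  ∑≢ G                                   ≡⟨ ∑≢-suc G ⟩
  row + (∑ (λ i → G (fs i) fz) + ∑≢ G')  ≡⟨ cong₂ (λ c d → row + (c + d))
                                                  (∑-cong (λ i → G-sym (fs i) fz))
                                                  (∑≢-symmetric G' (λ i j → G-sym (fs i) (fs j))) ⟩
  row + (row + (∑< G' + ∑< G'))          ≡⟨ rearrange row (∑< G') ⟩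
  (row + ∑< G') + (row + ∑< G')          ≡⟨ cong (λ s → s + s) (∑<-suc G) ⟨
  ∑< G + ∑< G                            ∎
  where
  open ≡-Reasoning
  row : ℚ
  row = ∑ (λ j → G fz (fs j))
  G' : Fin n → Fin n → ℚ
  G' i j = G (fs i) (fs j)
  rearrange : ∀ r s → r + (r + (s + s)) ≡ (r + s) + (r + s)
  rearrange = solve-∀ ℚ-ring

-- The terms with i = 0 sum to ∑< G₀; those with j = 0 form the pair sum ∑≢ Gᵥ over a slice,
-- which by symmetry is twice ∑< G₀ again; the remaining terms are handled by induction.
∑≢<-symmetric : ∀ {n} (G : Fin n → Fin n → Fin n → ℚ) →
                (∀ i j l → G i j l ≡ G j i l) → (∀ i j l → G i j l ≡ G i l j) →
                ∑≢< G ≡ ∑<< G + ∑<< G + ∑<< G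
∑≢<-symmetric {zero}  G sym₁₂ sym₂₃ = refl
∑≢<-symmetric {suc n} G sym₁₂ sym₂₃ = begin
  ∑≢< G
    ≡⟨ ∑≢<-suc G ⟩
  ∑< G₀ + (∑≢ Gᵥ + ∑≢< G')
    ≡⟨ cong₂ (λ c d → ∑< G₀ + (c + d)) slice
             (∑≢<-symmetric G' (λ i j l → sym₁₂ (fs i) (fs j) (fs l))
                               (λ i j l → sym₂₃ (fs i) (fs j) (fs l))) ⟩
  ∑< G₀ + ((∑< G₀ + ∑< G₀) + (∑<< G' + ∑<< G' + ∑<< G'))
    ≡⟨ rearrange (∑< G₀) (∑<< G') ⟩
  (∑< G₀ + ∑<< G') + (∑< G₀ + ∑<< G') + (∑< G₀ + ∑<< G')
    ≡⟨ cong (λ s → s + s + s) (∑<<-suc G) ⟨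
  ∑<< G + ∑<< G + ∑<< G
    ∎
  where
  open ≡-Reasoning
  G₀ Gᵥ : Fin n → Fin n → ℚ
  G₀ j l = G fz (fs j) (fs l)
  Gᵥ i l = G (fs i) fz (fs l)
  G' : Fin n → Fin n → Fin n → ℚ
  G' i j l = G (fs i) (fs j) (fs l)
  sym₁₃ : ∀ i j l → G i j l ≡ G l j i
  sym₁₃ i j l = trans (sym₁₂ i j l) (trans (sym₂₃ j i l) (sym₁₂ j l i))
  slice : ∑≢ Gᵥ ≡ ∑< G₀ + ∑< G₀
  slice = trans (∑≢-symmetric Gᵥ (λ i l → sym₁₃ (fs i) fz (fs l)))
                (cong (λ s → s + s) (∑-cong (λ i → ∑[]-cong (i <ᶠ_) (λ l _ → sym₁₂ (fs i) fz (fs l)))))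
  rearrange : ∀ r s → r + ((r + r) + (s + s + s)) ≡ (r + s) + (r + s) + (r + s)
  rearrange = solve-∀ ℚ-ring

∑[]≢-symmetric : ∀ {n} (P : Fin n → Bool) (G : Fin n → Fin n → ℚ) → (∀ i j → G i j ≡ G j i) →
                  ∑[ P ] (λ i → ∑[ (λ j → P j ∧ not (i ≡ᶠ j)) ] (G i))
                    ≡ ∑[ P ] (λ i → ∑[ (λ j → P j ∧ (i <ᶠ j)) ] (G i))
                      + ∑[ P ] (λ i → ∑[ (λ j → P j ∧ (i <ᶠ j)) ] (G i))
∑[]≢-symmetric {n} P G G-sym = begin
  ∑[ P ] (λ i → ∑[ (λ j → P j ∧ not (i ≡ᶠ j)) ] (G i))  ≡⟨ restrict (λ i j → not (i ≡ᶠ j)) ⟩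
  ∑≢ Gᴾ                                                 ≡⟨ ∑≢-symmetric Gᴾ Gᴾ-sym ⟩
  ∑< Gᴾ + ∑< Gᴾ                                         ≡⟨ cong (λ s → s + s) (restrict _<ᶠ_) ⟨
  ∑[ P ] (λ i → ∑[ (λ j → P j ∧ (i <ᶠ j)) ] (G i))
    + ∑[ P ] (λ i → ∑[ (λ j → P j ∧ (i <ᶠ j)) ] (G i))  ∎
  where
  open ≡-Reasoning
  Gᴾ : Fin n → Fin n → ℚ
  Gᴾ i j = if P i ∧ P j then G i j else 0ℚ
  Gᴾ-sym : ∀ i j → Gᴾ i j ≡ Gᴾ j i
  Gᴾ-sym i j = cong₂ (λ b x → if b then x else 0ℚ) (∧-comm (P i) (P j)) (G-sym i j)
  restrict : (R : Fin n → Fin n → Bool) →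
             ∑[ P ] (λ i → ∑[ (λ j → P j ∧ R i j) ] (G i)) ≡ ∑ (λ i → ∑[ R i ] (Gᴾ i))
  restrict R = ∑-cong (λ i → if-∑[]-∧ (P i) P (R i) (G i))

∑[]≢<-symmetric : ∀ {n} (P : Fin n → Bool) (G : Fin n → Fin n → Fin n → ℚ) →
                   (∀ i j l → G i j l ≡ G j i l) → (∀ i j l → G i j l ≡ G i l j) →
                   ∑[ P ] (λ i → ∑[ (λ j → P j ∧ not (i ≡ᶠ j)) ] (λ j →
                     ∑[ (λ l → P l ∧ not (i ≡ᶠ l) ∧ (j <ᶠ l)) ] (G i j)))
                     ≡ ∑[ P ] (λ i → ∑[ (λ j → P j ∧ (i <ᶠ j)) ] (λ j → ∑[ (λ l → P l ∧ (j <ᶠ l)) ] (G i j)))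
                       + ∑[ P ] (λ i → ∑[ (λ j → P j ∧ (i <ᶠ j)) ] (λ j → ∑[ (λ l → P l ∧ (j <ᶠ l)) ] (G i j)))
                       + ∑[ P ] (λ i → ∑[ (λ j → P j ∧ (i <ᶠ j)) ] (λ j → ∑[ (λ l → P l ∧ (j <ᶠ l)) ] (G i j)))
∑[]≢<-symmetric {n} P G sym₁₂ sym₂₃ =
  trans (restrict (λ i j → not (i ≡ᶠ j)) (λ i j l → not (i ≡ᶠ l) ∧ (j <ᶠ l)))
        (trans (∑≢<-symmetric Gᴾ Gᴾ-sym₁₂ Gᴾ-sym₂₃)
               (cong (λ s → s + s + s) (sym (restrict _<ᶠ_ (λ i → _<ᶠ_)))))
  where
  Gᴾ : Fin n → Fin n → Fin n → ℚ
  Gᴾ i j l = if (P i ∧ P j) ∧ P l then G i j l else 0ℚ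
  Gᴾ-sym₁₂ : ∀ i j l → Gᴾ i j l ≡ Gᴾ j i l
  Gᴾ-sym₁₂ i j l = cong₂ (λ b x → if b then x else 0ℚ)
                         (cong (_∧ P l) (∧-comm (P i) (P j))) (sym₁₂ i j l)
  Gᴾ-sym₂₃ : ∀ i j l → Gᴾ i j l ≡ Gᴾ i l j
  Gᴾ-sym₂₃ i j l = cong₂ (λ b x → if b then x else 0ℚ)
    (trans (∧-assoc (P i) (P j) (P l))
           (trans (cong (P i ∧_) (∧-comm (P j) (P l))) (sym (∧-assoc (P i) (P l) (P j)))))
    (sym₂₃ i j l)
  restrict : (R : Fin n → Fin n → Bool) (S : Fin n → Fin n → Fin n → Bool) →
             ∑[ P ] (λ i → ∑[ (λ j → P j ∧ R i j) ] (λ j → ∑[ (λ l → P l ∧ S i j l) ] (G i j)))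
                     ≡ ∑ (λ i → ∑[ R i ] (λ j → ∑[ S i j ] (Gᴾ i j)))
  restrict R S = ∑-cong row
    where
    row : ∀ i → (if P i then ∑[ (λ j → P j ∧ R i j) ] (λ j → ∑[ (λ l → P l ∧ S i j l) ] (G i j)) else 0ℚ)
                ≡ ∑[ R i ] (λ j → ∑[ S i j ] (Gᴾ i j))
    row i = trans (if-∑[]-∧ (P i) P (R i) (λ j → ∑[ (λ l → P l ∧ S i j l) ] (G i j)))
                  (∑[]-cong (R i) {λ j → if P i ∧ P j then ∑[ (λ l → P l ∧ S i j l) ] (G i j) else 0ℚ}
                            (λ j _ → if-∑[]-∧ (P i ∧ P j) P (S i j) (G i j)))

module _ {k : ℕ} {h : Fin k → ℕ} {X : Fin k → Fin k → Fin k → ℚ} (ros : IsROS h X) where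
  open IsROS ros

  X-ijj≡0 : ∀ {i j} → i ≢ j → X i j j ≡ 0ℚ
  X-ijj≡0 {i} {j} i≢j = trans (sym₁₂ i j j) (trans (sym₂₃ j i j) (offDiag j i (i≢j ∘ sym)))

  X-iji≡0 : ∀ {i j} → i ≢ j → X i j i ≡ 0ℚ
  X-iji≡0 {i} {j} i≢j = trans (sym₂₃ i j i) (offDiag i j i≢j)

module _ {k : ℕ} (a : Fin k) (m : ℕ) where

  inMᵇ⇒InM : ∀ {i} → inMᵇ a m i ≡ true → InM a m i
  inMᵇ⇒InM {i} i∈M with Equivalence.to T-∧ (Equivalence.from T-≡ i∈M)
  ... | a≤i , i<a+m = ℕ.≤ᵇ⇒≤ (toℕ a) (toℕ i) a≤i , ℕ.<ᵇ⇒< (toℕ i) (toℕ a +ℕ m) i<a+m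

  InM⇒inMᵇ : ∀ {i} → InM a m i → inMᵇ a m i ≡ true
  InM⇒inMᵇ (a≤i , i<a+m) = Equivalence.to T-≡ (Equivalence.from T-∧ (ℕ.≤⇒≤ᵇ a≤i , ℕ.<⇒<ᵇ i<a+m))

  notInMᵇ⇒¬InM : ∀ {i} → notInMᵇ a m i ≡ true → ¬ InM a m i
  notInMᵇ⇒¬InM i∉M i∈M = case trans (sym (cong not (InM⇒inMᵇ i∈M))) i∉M of λ ()

module SimilarBlock {k : ℕ} (h : Fin k → ℕ) (m : ℕ) (a : Fin k) (a+m≤k : toℕ a +ℕ m ≤ k)
                    (h-const : ∀ α → InM a m α → h α ≡ h a)
                    {X : Fin k → Fin k → Fin k → ℚ} (ros : IsROS h X)
                    {Y₁ : Fin k → Fin k → ℚ} {Y₂ : Fin k → ℚ} {Y₃ : ℚ}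
                    (sim : IsSimilar a m X Y₁ Y₂ Y₃) (2≤m : 2 ≤ m) where
  open IsROS ros
  open IsSimilar sim

  H : Fin k → ℚ
  H i = ℕ→ℚ (h i)

  inM outM : Fin k → Bool
  inM  = inMᵇ a m
  outM = notInMᵇ a m

  outM∖ : Fin k → Fin k → Bool
  outM∖ i l = outM l ∧ not (i ≡ᶠ l)

  S T : Fin k → ℚ
  S i = ∑[ outM∖ i ] (λ l → H i * H l)
  T i = ∑[ outM∖ i ] (λ j → ∑[ (λ l → outM l ∧ not (i ≡ᶠ l) ∧ (j <ᶠ l)) ] (X i j))

  P₂ T₃ : ℚ
  P₂ = ∑[ outM ] (λ i → ∑[ (λ j → outM j ∧ (i <ᶠ j)) ] (λ j → H i * H j))
  T₃ = ∑[ outM ] (λ i → ∑[ (λ j → outM j ∧ (i <ᶠ j)) ] (λ j → ∑[ (λ l → outM l ∧ (j <ᶠ l)) ] (X i j)))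

  a∈M : InM a m a
  a∈M = ℕ.≤-refl , ℕ.m<m+n (toℕ a) (ℕ.<-≤-trans z<s 2≤m)

  2+a≤a+m : suc (suc (toℕ a)) ≤ toℕ a +ℕ m
  2+a≤a+m = subst (_≤ toℕ a +ℕ m) (ℕ.+-comm (toℕ a) 2) (ℕ.+-monoʳ-≤ (toℕ a) 2≤m)

  1+a<k : suc (toℕ a) < k
  1+a<k = ℕ.≤-trans 2+a≤a+m a+m≤k

  a₁ : Fin k
  a₁ = fromℕ< 1+a<k

  a₁∈M : InM a m a₁
  a₁∈M rewrite Fin.toℕ-fromℕ< 1+a<k = ℕ.n≤1+n (toℕ a) , 2+a≤a+m

  a≢a₁ : a ≢ a₁
  a≢a₁ a≡a₁ = ℕ.1+n≢n (sym (trans (cong toℕ a≡a₁) (Fin.toℕ-fromℕ< 1+a<k)))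

  M∖a M∖a∖a₁ : Fin k → Bool
  M∖a l = inM l ∧ not (a ≡ᶠ l)
  M∖a∖a₁ l = M∖a l ∧ not (a₁ ≡ᶠ l)

  count-M : count inM ≡ m
  count-M = count-interval (toℕ a) m a+m≤k

  count-M∖a : count M∖a ≡ m ∸ 1
  count-M∖a = cong (_∸ 1) (trans (sym (count-remove inM a (InM⇒inMᵇ a m a∈M))) count-M)

  count-M∖a∖a₁ : count M∖a∖a₁ ≡ m ∸ 2
  count-M∖a∖a₁ = cong (_∸ 2) (begin
    suc (suc (count M∖a∖a₁))  ≡⟨ cong suc (count-remove M∖a a₁ a₁∈M∖a) ⟨
    suc (count M∖a)           ≡⟨ count-remove inM a (InM⇒inMᵇ a m a∈M) ⟨
    count inM                 ≡⟨ count-M ⟩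
    m                         ∎)
    where
    open ≡-Reasoning
    a₁∈M∖a : M∖a a₁ ≡ true
    a₁∈M∖a = cong₂ (λ b c → b ∧ not c) (InM⇒inMᵇ a m a₁∈M) (≢⇒≡ᶠ-false a≢a₁)

  ∑[inM]-rowSum : ∀ i j → ∑[ inM ] (X i j) ≡ H i * H j - ∑[ outM ] (X i j)
  ∑[inM]-rowSum i j = trans (∑[]-complement inM (X i j)) (cong (_- ∑[ outM ] (X i j)) (rowSum i j))

  m*Y₁≡ : ∀ i j → ¬ InM a m i → ¬ InM a m j → ℕ→ℚ m * Y₁ i j ≡ H i * H j - ∑[ outM ] (X i j)
  m*Y₁≡ i j i∉M j∉M = trans (sym block) (∑[inM]-rowSum i j)
    where
    block : ∑[ inM ] (X i j) ≡ ℕ→ℚ m * Y₁ i j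
    block = ∑[]-constant-on inM (Y₁ i j) (λ l l∈M → sim₁ i j l i∉M j∉M (inMᵇ⇒InM a m l∈M)) count-M

  [m∸1]*Y₂≡ : ∀ i → ¬ InM a m i → ℕ→ℚ (m ∸ 1) * Y₂ i ≡ H i * H a - ∑[ outM∖ i ] (Y₁ i)
  [m∸1]*Y₂≡ i i∉M = begin
    ℕ→ℚ (m ∸ 1) * Y₂ i               ≡⟨ block ⟨
    ∑[ inM ] (X i a)                  ≡⟨ ∑[inM]-rowSum i a ⟩
    H i * H a - ∑[ outM ] (X i a)     ≡⟨ cong (λ x → H i * H a - x) outside ⟩
    H i * H a - ∑[ outM∖ i ] (Y₁ i)   ∎
    where
    open ≡-Reasoning
    i≢a : i ≢ a
    i≢a refl = i∉M a∈M
    block : ∑[ inM ] (X i a) ≡ ℕ→ℚ (m ∸ 1) * Y₂ i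
    block = trans (∑[]-remove inM a (X i a) (X-ijj≡0 ros i≢a))
                  (∑[]-constant-on M∖a (Y₂ i) on-block count-M∖a)
      where
      on-block : ∀ l → M∖a l ≡ true → X i a l ≡ Y₂ i
      on-block l l∈M∖a with ∧-not-≡ᶠ⇒ (inM l) a l l∈M∖a
      ... | l∈M , a≢l = sim₂ i a l i∉M a∈M (inMᵇ⇒InM a m l∈M) a≢l
    outside : ∑[ outM ] (X i a) ≡ ∑[ outM∖ i ] (Y₁ i)
    outside = trans (∑[]-remove outM i (X i a) (X-iji≡0 ros i≢a)) (∑[]-cong (outM∖ i) off-block)
      where
      off-block : ∀ l → outM∖ i l ≡ true → X i a l ≡ Y₁ i l
      off-block l l∈ with ∧-not-≡ᶠ⇒ (outM l) i l l∈
      ... | l∉M , _ = trans (sym₂₃ i a l) (sim₁ i l a i∉M (notInMᵇ⇒¬InM a m l∉M) a∈M)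

  m*∑Y₁≡ : ∀ i → ¬ InM a m i → ℕ→ℚ m * ∑[ outM∖ i ] (Y₁ i) ≡ S i - (T i + T i)
  m*∑Y₁≡ i i∉M = begin
    ℕ→ℚ m * ∑[ outM∖ i ] (Y₁ i)                           ≡⟨ ∑[]-*ˡ (outM∖ i) (ℕ→ℚ m) (Y₁ i) ⟨
    ∑[ outM∖ i ] (λ l → ℕ→ℚ m * Y₁ i l)                  ≡⟨ ∑[]-cong (outM∖ i) (λ l l∈ →
                                                               m*Y₁≡ i l i∉M (notInMᵇ⇒¬InM a m (∈outM l l∈))) ⟩
    ∑[ outM∖ i ] (λ l → H i * H l - ∑[ outM ] (X i l))    ≡⟨ ∑[]-- (outM∖ i) (λ l → H i * H l)
                                                                           (λ l → ∑[ outM ] (X i l)) ⟩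
    S i - ∑[ outM∖ i ] (λ l → ∑[ outM ] (X i l))          ≡⟨ cong (λ x → S i - x) pairs ⟩
    S i - (T i + T i)                                     ∎
    where
    open ≡-Reasoning
    ∈outM : ∀ l → outM∖ i l ≡ true → outM l ≡ true
    ∈outM l l∈ with ∧-not-≡ᶠ⇒ (outM l) i l l∈
    ... | l∉M , _ = l∉M
    pairs : ∑[ outM∖ i ] (λ l → ∑[ outM ] (X i l)) ≡ T i + T i
    pairs = begin
      ∑[ outM∖ i ] (λ l → ∑[ outM ] (X i l))
        ≡⟨ ∑[]-cong (outM∖ i) drop-i-and-l ⟩
      ∑[ outM∖ i ] (λ l → ∑[ (λ j → outM∖ i j ∧ not (l ≡ᶠ j)) ] (X i l))
        ≡⟨ ∑[]≢-symmetric (outM∖ i) (X i) (sym₂₃ i) ⟩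
      U + U
        ≡⟨ cong (λ t → t + t) (∑[]-cong (outM∖ i) (λ j _ →
             ∑[]-congᴾ (X i j) (λ l → ∧-assoc (outM l) (not (i ≡ᶠ l)) (j <ᶠ l)))) ⟩
      T i + T i ∎
      where
      U : ℚ
      U = ∑[ outM∖ i ] (λ j → ∑[ (λ l → outM∖ i l ∧ (j <ᶠ l)) ] (X i j))
      drop-i-and-l : ∀ l → outM∖ i l ≡ true →
                     ∑[ outM ] (X i l) ≡ ∑[ (λ j → outM∖ i j ∧ not (l ≡ᶠ j)) ] (X i l)
      drop-i-and-l l l∈ with ∧-not-≡ᶠ⇒ (outM l) i l l∈
      ... | _ , i≢l = trans (∑[]-remove outM i (X i l) (X-iji≡0 ros i≢l))
                            (∑[]-remove (outM∖ i) l (X i l) (X-ijj≡0 ros i≢l))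

  m*[m∸1]*Y₂≡ : ∀ i → ¬ InM a m i →
                ℕ→ℚ m * (ℕ→ℚ (m ∸ 1) * Y₂ i) ≡ ℕ→ℚ m * (H i * H a) - (S i - (T i + T i))
  m*[m∸1]*Y₂≡ i i∉M = begin
    ℕ→ℚ m * (ℕ→ℚ (m ∸ 1) * Y₂ i)
      ≡⟨ cong (ℕ→ℚ m *_) ([m∸1]*Y₂≡ i i∉M) ⟩
    ℕ→ℚ m * (H i * H a - ∑[ outM∖ i ] (Y₁ i))
      ≡⟨ distrib (ℕ→ℚ m) (H i * H a) (∑[ outM∖ i ] (Y₁ i)) ⟩
    ℕ→ℚ m * (H i * H a) - ℕ→ℚ m * ∑[ outM∖ i ] (Y₁ i)
      ≡⟨ cong (λ x → ℕ→ℚ m * (H i * H a) - x) (m*∑Y₁≡ i i∉M) ⟩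
    ℕ→ℚ m * (H i * H a) - (S i - (T i + T i))
      ∎
    where
    open ≡-Reasoning
    distrib : ∀ x y z → x * (y - z) ≡ x * y - x * z
    distrib = solve-∀ ℚ-ring

  [m∸2]*Y₃≡ : ℕ→ℚ (m ∸ 2) * Y₃ ≡ H a * H a - ∑[ outM ] Y₂
  [m∸2]*Y₃≡ = begin
    ℕ→ℚ (m ∸ 2) * Y₃                ≡⟨ block ⟨
    ∑[ inM ] (X a a₁)                ≡⟨ ∑[inM]-rowSum a a₁ ⟩
    H a * H a₁ - ∑[ outM ] (X a a₁)  ≡⟨ cong₂ _-_ (cong (λ x → H a * ℕ→ℚ x) (h-const a₁ a₁∈M))
                                                  (∑[]-cong outM off-block) ⟩
    H a * H a - ∑[ outM ] Y₂         ∎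
    where
    open ≡-Reasoning
    block : ∑[ inM ] (X a a₁) ≡ ℕ→ℚ (m ∸ 2) * Y₃
    block = trans (∑[]-remove inM a (X a a₁) (X-iji≡0 ros a≢a₁))
           (trans (∑[]-remove M∖a a₁ (X a a₁) (X-ijj≡0 ros a≢a₁))
                  (∑[]-constant-on M∖a∖a₁ Y₃ on-block count-M∖a∖a₁))
      where
      on-block : ∀ l → M∖a∖a₁ l ≡ true → X a a₁ l ≡ Y₃
      on-block l l∈ with ∧-not-≡ᶠ⇒ (M∖a l) a₁ l l∈
      ... | l∈M∖a , a₁≢l with ∧-not-≡ᶠ⇒ (inM l) a l l∈M∖a
      ... | l∈M , a≢l = sim₃ a a₁ l a∈M a₁∈M (inMᵇ⇒InM a m l∈M) a≢a₁ a₁≢l a≢l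
    off-block : ∀ l → outM l ≡ true → X a a₁ l ≡ Y₂ l
    off-block l l∉M = trans (sym₂₃ a a₁ l) (trans (sym₁₂ a l a₁)
                        (sim₂ l a a₁ (notInMᵇ⇒¬InM a m l∉M) a∈M a₁∈M a≢a₁))

  m*[m∸1]*∑Y₂≡ : ℕ→ℚ m * (ℕ→ℚ (m ∸ 1) * ∑[ outM ] Y₂)
                   ≡ ℕ→ℚ m * (H a * ∑[ outM ] H) - ((P₂ + P₂) - ((T₃ + T₃ + T₃) + (T₃ + T₃ + T₃)))
  m*[m∸1]*∑Y₂≡ = begin
    ℕ→ℚ m * (ℕ→ℚ (m ∸ 1) * ∑[ outM ] Y₂)
      ≡⟨ cong (ℕ→ℚ m *_) (∑[]-*ˡ outM (ℕ→ℚ (m ∸ 1)) Y₂) ⟨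
    ℕ→ℚ m * ∑[ outM ] (λ l → ℕ→ℚ (m ∸ 1) * Y₂ l)
      ≡⟨ ∑[]-*ˡ outM (ℕ→ℚ m) (λ l → ℕ→ℚ (m ∸ 1) * Y₂ l) ⟨
    ∑[ outM ] (λ l → ℕ→ℚ m * (ℕ→ℚ (m ∸ 1) * Y₂ l))
      ≡⟨ ∑[]-cong outM (λ l l∉M → m*[m∸1]*Y₂≡ l (notInMᵇ⇒¬InM a m l∉M)) ⟩
    ∑[ outM ] (λ l → ℕ→ℚ m * (H l * H a) - (S l - (T l + T l)))
      ≡⟨ ∑[]-- outM (λ l → ℕ→ℚ m * (H l * H a)) (λ l → S l - (T l + T l)) ⟩
    ∑[ outM ] (λ l → ℕ→ℚ m * (H l * H a)) - ∑[ outM ] (λ l → S l - (T l + T l))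
      ≡⟨ cong₂ _-_ pull-constants symmetrise ⟩
    ℕ→ℚ m * (H a * ∑[ outM ] H) - ((P₂ + P₂) - ((T₃ + T₃ + T₃) + (T₃ + T₃ + T₃))) ∎
    where
    open ≡-Reasoning
    pull-constants : ∑[ outM ] (λ l → ℕ→ℚ m * (H l * H a)) ≡ ℕ→ℚ m * (H a * ∑[ outM ] H)
    pull-constants = trans (∑[]-*ˡ outM (ℕ→ℚ m) (λ l → H l * H a))
      (cong (ℕ→ℚ m *_) (trans (∑[]-cong outM (λ l _ → ℚ.*-comm (H l) (H a))) (∑[]-*ˡ outM (H a) H)))
    symmetrise : ∑[ outM ] (λ l → S l - (T l + T l)) ≡ (P₂ + P₂) - ((T₃ + T₃ + T₃) + (T₃ + T₃ + T₃))
    symmetrise = trans (∑[]-- outM S (λ l → T l + T l))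
      (cong₂ _-_ (∑[]≢-symmetric outM (λ i j → H i * H j) (λ i j → ℚ.*-comm (H i) (H j)))
                 (trans (∑[]-+ outM T T) (cong (λ t → t + t) (∑[]≢<-symmetric outM X sym₁₂ sym₂₃))))

  Y₁-formula : .{{_ : NonZero m}} → ∀ i j → ¬ InM a m i → ¬ InM a m j →
               Y₁ i j ≡ inv m * (H i * H j - ∑[ outM ] (X i j))
  Y₁-formula i j i∉M j∉M = divide-by m (m*Y₁≡ i j i∉M j∉M)

  Y₂-formula : .{{_ : NonZero m}} .{{_ : NonZero (m ∸ 1)}} → ∀ i → ¬ InM a m i →
               Y₂ i ≡ inv (m ∸ 1) * (H i * H a - inv m * S i + ℕ→ℚ 2 * inv m * T i)
  Y₂-formula i i∉M = begin
    Y₂ i                                                    ≡⟨ divide-by (m ∸ 1) ([m∸1]*Y₂≡ i i∉M) ⟩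
    inv (m ∸ 1) * (H i * H a - ∑[ outM∖ i ] (Y₁ i))          ≡⟨ cong (λ x → inv (m ∸ 1) * (H i * H a - x))
                                                                     (divide-by m (m*∑Y₁≡ i i∉M)) ⟩
    inv (m ∸ 1) * (H i * H a - inv m * (S i - (T i + T i)))  ≡⟨ cong (inv (m ∸ 1) *_)
                                                                     (expand (H i * H a) (inv m) (S i) (T i)) ⟩
    inv (m ∸ 1) * (H i * H a - inv m * S i + ℕ→ℚ 2 * inv m * T i) ∎
    where
    open ≡-Reasoning
    expand : ∀ x u s t → x - u * (s - (t + t)) ≡ x - u * s + ℕ→ℚ 2 * u * t
    expand = solve-∀ ℚ-ring

  Y₃-formula : .{{_ : NonZero (m *ℕ (m ∸ 1) *ℕ (m ∸ 2))}} →
               Y₃ ≡ inv (m *ℕ (m ∸ 1) *ℕ (m ∸ 2)) *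
                      (ℕ→ℚ (m *ℕ (m ∸ 1)) * (H a * H a) - ℕ→ℚ m * H a * ∑[ outM ] H
                       + ℕ→ℚ 2 * P₂ - ℕ→ℚ 6 * T₃)
  Y₃-formula = divide-by (m *ℕ (m ∸ 1) *ℕ (m ∸ 2)) (begin
    ℕ→ℚ (m *ℕ (m ∸ 1) *ℕ (m ∸ 2)) * Y₃
      ≡⟨ cong (_* Y₃) (ℕ→ℚ-* (m *ℕ (m ∸ 1)) (m ∸ 2)) ⟩
    ℕ→ℚ (m *ℕ (m ∸ 1)) * ℕ→ℚ (m ∸ 2) * Y₃
      ≡⟨ ℚ.*-assoc (ℕ→ℚ (m *ℕ (m ∸ 1))) (ℕ→ℚ (m ∸ 2)) Y₃ ⟩
    ℕ→ℚ (m *ℕ (m ∸ 1)) * (ℕ→ℚ (m ∸ 2) * Y₃)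
      ≡⟨ cong (ℕ→ℚ (m *ℕ (m ∸ 1)) *_) [m∸2]*Y₃≡ ⟩
    ℕ→ℚ (m *ℕ (m ∸ 1)) * (H a * H a - ∑[ outM ] Y₂)
      ≡⟨ cong (λ c → c * (H a * H a - ∑[ outM ] Y₂)) (ℕ→ℚ-* m (m ∸ 1)) ⟩
    ℕ→ℚ m * ℕ→ℚ (m ∸ 1) * (H a * H a - ∑[ outM ] Y₂)
      ≡⟨ distrib (ℕ→ℚ m) (ℕ→ℚ (m ∸ 1)) (H a * H a) (∑[ outM ] Y₂) ⟩
    ℕ→ℚ m * ℕ→ℚ (m ∸ 1) * (H a * H a) - ℕ→ℚ m * (ℕ→ℚ (m ∸ 1) * ∑[ outM ] Y₂)
      ≡⟨ cong₂ _-_ (cong (_* (H a * H a)) (ℕ→ℚ-* m (m ∸ 1))) (sym m*[m∸1]*∑Y₂≡) ⟨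
    ℕ→ℚ (m *ℕ (m ∸ 1)) * (H a * H a)
      - (ℕ→ℚ m * (H a * ∑[ outM ] H) - ((P₂ + P₂) - ((T₃ + T₃ + T₃) + (T₃ + T₃ + T₃))))
      ≡⟨ collect (ℕ→ℚ (m *ℕ (m ∸ 1)) * (H a * H a)) (ℕ→ℚ m) (H a) (∑[ outM ] H) P₂ T₃ ⟩
    ℕ→ℚ (m *ℕ (m ∸ 1)) * (H a * H a) - ℕ→ℚ m * H a * ∑[ outM ] H + ℕ→ℚ 2 * P₂ - ℕ→ℚ 6 * T₃ ∎)
    where
    open ≡-Reasoning
    distrib : ∀ μ μ₁ x y → μ * μ₁ * (x - y) ≡ μ * μ₁ * x - μ * (μ₁ * y)
    distrib = solve-∀ ℚ-ring
    collect : ∀ x μ h σ p t → x - (μ * (h * σ) - ((p + p) - ((t + t + t) + (t + t + t))))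
                              ≡ x - μ * h * σ + ℕ→ℚ 2 * p - ℕ→ℚ 6 * t
    collect = solve-∀ ℚ-ring

mainTheorem15 :
  (k : ℕ) (h : Fin k → ℕ) → (∀ i → 1 ≤ h i) →
  (m : ℕ) → 3 ≤ m →
  (a : Fin k) → toℕ a +ℕ m ≤ k →
  (∀ α → InM a m α → h α ≡ h a) →
  (X : Fin k → Fin k → Fin k → ℚ) → IsROS h X →
  (Y₁ : Fin k → Fin k → ℚ) (Y₂ : Fin k → ℚ) (Y₃ : ℚ) →
  IsSimilar a m X Y₁ Y₂ Y₃ →
  (∀ i j → ¬ InM a m i → ¬ InM a m j → i ≢ j →
     Y₁ i j ≡ inv m * (ℕ→ℚ (h i) * ℕ→ℚ (h j)
                        - ∑[ notInMᵇ a m ] (λ l → X i j l)))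
  × (∀ i → ¬ InM a m i →
     Y₂ i ≡ inv (m ∸ 1) *
       ( ℕ→ℚ (h i) * ℕ→ℚ (h a)
       - inv m * ∑[ (λ l → notInMᵇ a m l ∧ not (i ≡ᶠ l)) ]
                   (λ l → ℕ→ℚ (h i) * ℕ→ℚ (h l))
       + ℕ→ℚ 2 * inv m *
           ∑[ (λ j → notInMᵇ a m j ∧ not (i ≡ᶠ j)) ] (λ j →
             ∑[ (λ l → notInMᵇ a m l ∧ not (i ≡ᶠ l) ∧ (j <ᶠ l)) ] (λ l →
               X i j l))))
  × (Y₃ ≡ inv (m *ℕ (m ∸ 1) *ℕ (m ∸ 2)) *
       ( ℕ→ℚ (m *ℕ (m ∸ 1)) * (ℕ→ℚ (h a) * ℕ→ℚ (h a))
       - ℕ→ℚ m * ℕ→ℚ (h a) * ∑[ notInMᵇ a m ] (λ i → ℕ→ℚ (h i))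
       + ℕ→ℚ 2 * ∑[ notInMᵇ a m ] (λ i →
                    ∑[ (λ j → notInMᵇ a m j ∧ (i <ᶠ j)) ] (λ j →
                      ℕ→ℚ (h i) * ℕ→ℚ (h j)))
       - ℕ→ℚ 6 * ∑[ notInMᵇ a m ] (λ i →
                    ∑[ (λ j → notInMᵇ a m j ∧ (i <ᶠ j)) ] (λ j →
                      ∑[ (λ l → notInMᵇ a m l ∧ (j <ᶠ l)) ] (λ l →
                        X i j l)))))
-- Matching on 3 ≤ m exposes m = 3 + n, which supplies the NonZero instances for the denominators.
mainTheorem15 k h _ m 3≤m@(s≤s (s≤s (s≤s _))) a a+m≤k h-const X ros Y₁ Y₂ Y₃ sim =
  (λ i j i∉M j∉M _ → Y₁-formula i j i∉M j∉M) , Y₂-formula , Y₃-formula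
  where open SimilarBlock h m a a+m≤k h-const ros sim (ℕ.≤-trans (ℕ.n≤1+n 2) 3≤m)
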